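{- Let $G$ and $H$ be two strongly connected digraphs, each with at least two vertices. Then $$\lambda_2(G\Box H)\le \min\{\lambda(G)\,|V(H)|,\ \lambda(H)\,|V(G)|,\ \delta^+(G)+\delta^+(H),\ \delta^-(G)+\delta^-(H)\}.$$ Moreover, this bound is sharp (there exist such $G,H$ for which equality holds).
   Context: All digraphs are finite, without loops or parallel arcs. For a digraph $D$, $\lambda(D)$ is its arc-strong connectivity, and $\delta^+(D)$, $\delta^-(D)$ are its minimum out-degree and in-degree. For a digraph $D$ and $S\subseteq V(D)$, an $S$-strong subgraph is a strongly connected subgraph of $D$ containing all vertices of $S$; $\lambda_S(D)$ is the maximum number of pairwise arc-disjoint $S$-strong subgraphs of $D$; and for $2\le k\le |V(D)|$, the strong subgraph $k$-arc-connectivity is $\lambda_k(D)=\min\{\lambda_S(D): S\subseteq V(D),\ |S|=k\}$. The Cartesian product $G\Box H$ has vertex set $V(G)\times V(H)$, and $(x,x')(y,y')$ is an arc iff either $xy\in A(G)$ and $x'=y'$, or $x=y$ and $x'y'\in A(H)$. -}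

module Defs where

open import Data.Nat using (ℕ; zero; suc; _+_; _*_; _≤_; _<_; _⊓_)
open import Data.Bool using (Bool; true; false; _∧_; _∨_; not)
open import Data.Fin using (Fin; zero; suc; remQuot; _≟_)
open import Data.Fin.Subset using (Subset; _∈_; _⊆_; ∣_∣)
open import Data.Vec using (tabulate)
open import Data.Product using (Σ; _×_; _,_; proj₁; proj₂; ∃)
open import Relation.Nullary using (¬_; Dec; yes; no)
open import Relation.Nullary.Decidable using (⌊_⌋)
open import Relation.Binary.PropositionalEquality using (_≡_; _≢_)

-- Finite digraphs on vertex set Fin n, arcs given by a Boolean
-- adjacency relation (so no parallel arcs).

record Digraph : Set where
  constructor digraph
  field
    n   : ℕ
    adj : Fin n → Fin n → Bool

open Digraph public

Loopless : Digraph → Set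
Loopless D = ∀ i → adj D i i ≡ false

ArcSet : ℕ → Set
ArcSet n = Fin n → Fin n → Bool

data Reach {n : ℕ} (B : ArcSet n) : Fin n → Fin n → Set where
  here : ∀ {u} → Reach B u u
  step : ∀ {u w v} → B u w ≡ true → Reach B w v → Reach B u v

Strong : Digraph → Set
Strong D = ∀ u v → Reach (adj D) u v

sumFin : (n : ℕ) → (Fin n → ℕ) → ℕ
sumFin zero    f = 0
sumFin (suc n) f = f zero + sumFin n (λ i → f (suc i))

arcCount : {n : ℕ} → ArcSet n → ℕ
arcCount {n} X = sumFin n (λ i → ∣ tabulate (X i) ∣)

-- minimum over the vertex set (convention: 0 on the empty set;
-- only used for digraphs with at least two vertices)
minFin : (n : ℕ) → (Fin n → ℕ) → ℕ
minFin zero          f = 0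
minFin (suc zero)    f = f zero
minFin (suc (suc n)) f = f zero ⊓ minFin (suc n) (λ i → f (suc i))

outdeg indeg : (D : Digraph) → Fin (n D) → ℕ
outdeg D v = ∣ tabulate (λ j → adj D v j) ∣
indeg  D v = ∣ tabulate (λ j → adj D j v) ∣

δ⁺ δ⁻ : Digraph → ℕ
δ⁺ D = minFin (n D) (outdeg D)
δ⁻ D = minFin (n D) (indeg D)

removeArcs : (D : Digraph) → ArcSet (n D) → Digraph
removeArcs D X = digraph (n D) (λ i j → adj D i j ∧ not (X i j))

ArcStrong : Digraph → ℕ → Set
ArcStrong D k = ∀ (X : ArcSet (n D)) →
  (∀ i j → X i j ≡ true → adj D i j ≡ true) →
  arcCount X < k → Strong (removeArcs D X)

IsArcConn : Digraph → ℕ → Set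
IsArcConn D m = ArcStrong D m × ¬ ArcStrong D (suc m)

record Subgraph (D : Digraph) : Set where
  constructor subgraph
  field
    verts  : Subset (n D)
    arcs   : ArcSet (n D)
    arcs⊆  : ∀ i j → arcs i j ≡ true → adj D i j ≡ true
    ends∈  : ∀ i j → arcs i j ≡ true → (i ∈ verts) × (j ∈ verts)

open Subgraph public

IsSStrong : (D : Digraph) → Subset (n D) → Subgraph D → Set
IsSStrong D S F = (S ⊆ verts F) ×
  (∀ u v → u ∈ verts F → v ∈ verts F → Reach (arcs F) u v)

HasDisjoint : (D : Digraph) → Subset (n D) → ℕ → Set
HasDisjoint D S k = Σ (Fin k → Subgraph D) λ F →
  (∀ i → IsSStrong D S (F i)) ×
  (∀ i j → i ≢ j → ∀ a b → arcs (F i) a b ≡ true → arcs (F j) a b ≡ false)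

IsLambdaS : (D : Digraph) → Subset (n D) → ℕ → Set
IsLambdaS D S m = HasDisjoint D S m × (∀ k → HasDisjoint D S k → k ≤ m)

IsLambdaK : ℕ → Digraph → ℕ → Set
IsLambdaK k D m =
  (∀ S → ∣ S ∣ ≡ k → ∀ l → IsLambdaS D S l → m ≤ l) ×
  (Σ (Subset (n D)) λ S → ∣ S ∣ ≡ k × IsLambdaS D S m)

eqF : {n : ℕ} → Fin n → Fin n → Bool
eqF x y = ⌊ x ≟ y ⌋

_□_ : Digraph → Digraph → Digraph
G □ H = digraph (n G * n H) arc
  where
  arc : Fin (n G * n H) → Fin (n G * n H) → Bool
  arc p q with remQuot {n G} (n H) p | remQuot {n G} (n H) q
  ... | (x , x') | (y , y') =
    (adj G x y ∧ eqF x' y') ∨ (eqF x y ∧ adj H x' y')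

bound : Digraph → Digraph → ℕ → ℕ → ℕ
bound G H lG lH =
  ((lG * n H) ⊓ (lH * n G)) ⊓ ((δ⁺ G + δ⁺ H) ⊓ (δ⁻ G + δ⁻ H))

Admissible : Digraph → Set
Admissible D = Loopless D × Strong D × (2 ≤ n D)

{-# OPTIONS --safe #-}
-- Let m = λ₂(G □ H), so any two vertices p ≠ q lie in m arc-disjoint strong subgraphs.
-- Their first arcs out of p are distinct, so m ≤ d⁺(p) = d⁺_G(x) + d⁺_H(y) for p = (x, y);
-- dually for in-degrees.  For p = (u, y), q = (v, y) and an arc set X of G, projecting each
-- subgraph to G either gives a u–v path avoiding X, or the subgraph uses an arc lying over
-- an arc of X; these arcs are distinct and G □ H has only |X|·|V(H)| of them, so
-- m > λ(G)·|V(H)| would make G (λ(G)+1)-arc-strong.  Equality holds for K₂ □ K₂, the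
-- 4-cycle with both orientations, whose two oriented Hamiltonian cycles are arc-disjoint.
module Submission where

open import Defs
open import Data.Bool using (Bool; true; false; not; _∧_; _∨_)
open import Data.Bool.Properties using (∧-conicalˡ; ∧-conicalʳ; ∨-zeroʳ)
open import Data.Empty using (⊥-elim)
open import Data.Fin using (Fin; zero; suc; remQuot; combine; inject≤; punchIn; fromℕ<; _≟_)
open import Data.Fin.Properties using (injective⇒≤; remQuot-combine; combine-remQuot; combine-injectiveˡ; combine-injectiveʳ; punchInᵢ≢i; inject≤-injective; sequence)
open import Data.Fin.Subset using (Subset; _∈_; ∣_∣; ⊤)
open import Data.Fin.Subset.Properties using (∈⊤)
open import Data.List using (List; []; _∷_; _++_; map; length; lookup; cartesianProduct; allFin)
open import Data.List.Properties using (length-++; length-map; length-tabulate)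
open import Data.List.Membership.Propositional renaming (_∈_ to _∈ₗ_)
open import Data.List.Membership.Propositional.Properties
  using (∈-++⁺ˡ; ∈-++⁺ʳ; ∈-map⁺; ∈-cartesianProduct⁺; ∈-allFin)
open import Data.List.Relation.Unary.Any using (here; there; index)
open import Data.List.Relation.Unary.Any.Properties using (lookup-index)
open import Data.Nat using (ℕ; zero; suc; _+_; _*_; _≤_; _<_; _≤?_; z≤n; s≤s)
open import Data.Nat.Properties
  using (≤-trans; ≤-reflexive; ≤-pred; <⇒≱; *-monoˡ-≤; ⊓-glb; ⊓-sel; ≤∧≢⇒<; +-suc)
open import Data.Product using (Σ; ∃; _×_; _,_; proj₁; proj₂)
open import Data.Sum using (_⊎_; inj₁; inj₂; [_,_]; map₂)
open import Data.Sum.Properties using (inj₁-injective; inj₂-injective)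
import Data.Sum.Effectful.Left as SumLeft
open import Data.Vec using (tabulate)
open import Data.Vec.Properties using (lookup⇒[]=; lookup∘tabulate; tabulate-cong)
open import Function using (_∘_; flip)
open import Function.Definitions using (Injective)
open import Effect.Monad using (RawMonad)
open import Level using (0ℓ)
open import Relation.Nullary using (¬_; yes; no; contradiction)
open import Relation.Nullary.Decidable using (decidable-stable; ¬¬-excluded-middle)
open import Relation.Nullary.Negation using (¬¬-map; ¬¬-Monad)
open import Relation.Binary.PropositionalEquality hiding ([_])

eqF-refl : ∀ {n} (x : Fin n) → eqF x x ≡ true
eqF-refl x with x ≟ x
... | yes _ = refl
... | no x≢x = contradiction refl x≢x

eqF⇒≡ : ∀ {n} {x y : Fin n} → eqF x y ≡ true → x ≡ y
eqF⇒≡ {x = x} {y} e with x ≟ y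
... | yes x≡y = x≡y
... | no _ = contradiction e λ ()

≢⇒eqF-false : ∀ {n} {x y : Fin n} → x ≢ y → eqF x y ≡ false
≢⇒eqF-false {x = x} {y} x≢y with x ≟ y
... | yes x≡y = contradiction x≡y x≢y
... | no _ = refl

∨≡true : ∀ x {y} → x ∨ y ≡ true → x ≡ true ⊎ y ≡ true
∨≡true true _ = inj₁ refl
∨≡true false e = inj₂ e

injective⇒≤length : ∀ {A : Set} {k} (xs : List A) (f : Fin k → A) →
  Injective _≡_ _≡_ f → (∀ i → f i ∈ₗ xs) → k ≤ length xs
injective⇒≤length xs f f-inj f∈xs = injective⇒≤ λ {i} {j} same → f-inj (begin
  f i                          ≡⟨ lookup-index (f∈xs i) ⟩
  lookup xs (index (f∈xs i))   ≡⟨ cong (lookup xs) same ⟩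
  lookup xs (index (f∈xs j))   ≡⟨ lookup-index (f∈xs j) ⟨
  f j                          ∎)
  where open ≡-Reasoning

trues : ∀ {n} → (Fin n → Bool) → List (Fin n)
trues {zero} P = []
trues {suc n} P with P zero
... | true = zero ∷ map suc (trues (P ∘ suc))
... | false = map suc (trues (P ∘ suc))

∈-trues : ∀ {n} (P : Fin n → Bool) {i} → P i ≡ true → i ∈ₗ trues P
∈-trues {suc n} P {i} Pi with P zero in P0
∈-trues {suc n} P {zero} Pi | true = here refl
∈-trues {suc n} P {suc i} Pi | true = there (∈-map⁺ suc (∈-trues (P ∘ suc) Pi))
∈-trues {suc n} P {zero} Pi | false = contradiction (trans (sym P0) Pi) λ ()
∈-trues {suc n} P {suc i} Pi | false = ∈-map⁺ suc (∈-trues (P ∘ suc) Pi)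

length-trues : ∀ {n} (P : Fin n → Bool) → length (trues P) ≡ ∣ tabulate P ∣
length-trues {zero} P = refl
length-trues {suc n} P with P zero
... | true = cong suc (trans (length-map suc (trues (P ∘ suc))) (length-trues (P ∘ suc)))
... | false = trans (length-map suc (trues (P ∘ suc))) (length-trues (P ∘ suc))

concatFin : ∀ {A : Set} {n} → (Fin n → List A) → List A
concatFin {n = zero} f = []
concatFin {n = suc n} f = f zero ++ concatFin (f ∘ suc)

length-concatFin : ∀ {A : Set} {n} (f : Fin n → List A) →
  length (concatFin f) ≡ sumFin n (length ∘ f)
length-concatFin {n = zero} f = refl
length-concatFin {n = suc n} f =
  trans (length-++ (f zero)) (cong (length (f zero) +_) (length-concatFin (f ∘ suc)))

∈-concatFin : ∀ {A : Set} {n} (f : Fin n → List A) i {a} → a ∈ₗ f i → a ∈ₗ concatFin f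
∈-concatFin f zero a∈ = ∈-++⁺ˡ a∈
∈-concatFin f (suc i) a∈ = ∈-++⁺ʳ (f zero) (∈-concatFin (f ∘ suc) i a∈)

sumFin-cong : ∀ n {f g : Fin n → ℕ} → (∀ i → f i ≡ g i) → sumFin n f ≡ sumFin n g
sumFin-cong zero f≗g = refl
sumFin-cong (suc n) f≗g = cong₂ _+_ (f≗g zero) (sumFin-cong n (f≗g ∘ suc))

arcList : ∀ {n} → ArcSet n → List (Fin n × Fin n)
arcList X = concatFin λ s → map (s ,_) (trues (X s))

∈-arcList : ∀ {n} (X : ArcSet n) {s t} → X s t ≡ true → (s , t) ∈ₗ arcList X
∈-arcList X {s} Xst = ∈-concatFin _ s (∈-map⁺ (s ,_) (∈-trues (X s) Xst))

length-arcList : ∀ {n} (X : ArcSet n) → length (arcList X) ≡ arcCount X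
length-arcList {n} X = trans (length-concatFin (λ s → map (s ,_) (trues (X s)))) (sumFin-cong n λ s →
  trans (length-map (s ,_) (trues (X s))) (length-trues (X s)))

length-cartesianProduct : ∀ {A B : Set} (xs : List A) (ys : List B) →
  length (cartesianProduct xs ys) ≡ length xs * length ys
length-cartesianProduct [] ys = refl
length-cartesianProduct (x ∷ xs) ys = trans (length-++ (map (x ,_) ys))
  (cong₂ _+_ (length-map (x ,_) ys) (length-cartesianProduct xs ys))

nonempty⇒0<length : ∀ {A : Set} {a : A} {xs} → a ∈ₗ xs → 0 < length xs
nonempty⇒0<length (here _) = s≤s z≤n
nonempty⇒0<length (there _) = s≤s z≤n

pair : ∀ {n} → Fin n → Fin n → Subset n
pair p q = tabulate λ i → eqF i p ∨ eqF i q

∈-pairˡ : ∀ {n} (p q : Fin n) → p ∈ pair p q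
∈-pairˡ p q = lookup⇒[]= p (pair p q)
  (trans (lookup∘tabulate _ p) (cong (_∨ eqF p q) (eqF-refl p)))

∈-pairʳ : ∀ {n} (p q : Fin n) → q ∈ pair p q
∈-pairʳ p q = lookup⇒[]= q (pair p q)
  (trans (lookup∘tabulate _ q) (trans (cong (eqF q p ∨_) (eqF-refl q)) (∨-zeroʳ _)))

count-false : ∀ n → ∣ tabulate {n} (λ _ → false) ∣ ≡ 0
count-false zero = refl
count-false (suc n) = count-false n

eqF-suc : ∀ {n} (i p : Fin n) → eqF (suc i) (suc p) ≡ eqF i p
eqF-suc i p with i ≟ p
... | yes _ = refl
... | no _ = refl

count-eqF : ∀ {n} (p : Fin n) → ∣ tabulate (λ i → eqF i p) ∣ ≡ 1
count-eqF {suc n} zero = cong suc (count-false n)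
count-eqF {suc n} (suc p) = trans (cong ∣_∣ (tabulate-cong λ i → eqF-suc i p)) (count-eqF p)

count-∨ : ∀ {n} (P Q : Fin n → Bool) → (∀ i → P i ≡ true → Q i ≡ false) →
  ∣ tabulate (λ i → P i ∨ Q i) ∣ ≡ ∣ tabulate P ∣ + ∣ tabulate Q ∣
count-∨ {zero} P Q disjoint = refl
count-∨ {suc n} P Q disjoint with P zero in P0 | Q zero in Q0
... | true | true = contradiction (trans (sym (disjoint zero P0)) Q0) λ ()
... | true | false = cong suc (count-∨ (P ∘ suc) (Q ∘ suc) (disjoint ∘ suc))
... | false | true = trans (cong suc (count-∨ (P ∘ suc) (Q ∘ suc) (disjoint ∘ suc)))
                           (sym (+-suc ∣ tabulate (P ∘ suc) ∣ _))
... | false | false = count-∨ (P ∘ suc) (Q ∘ suc) (disjoint ∘ suc)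

∣pair∣≡2 : ∀ {n} {p q : Fin n} → p ≢ q → ∣ pair p q ∣ ≡ 2
∣pair∣≡2 {p = p} {q} p≢q = trans
  (count-∨ (λ i → eqF i p) (λ i → eqF i q) λ i i≡p → ≢⇒eqF-false λ i≡q → p≢q (trans (sym (eqF⇒≡ i≡p)) i≡q))
  (cong₂ _+_ (count-eqF p) (count-eqF q))

Reach-trans : ∀ {n} {B : ArcSet n} {u v w} → Reach B u v → Reach B v w → Reach B u w
Reach-trans here r = r
Reach-trans (step e r) r′ = step e (Reach-trans r r′)

Reach-reverse : ∀ {n} {B : ArcSet n} {u v} → Reach B u v → Reach (flip B) v u
Reach-reverse here = here
Reach-reverse (step e r) = Reach-trans (Reach-reverse r) (step e here)

Reach-mono : ∀ {n} {B C : ArcSet n} → (∀ {u w} → B u w ≡ true → C u w ≡ true) →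
  ∀ {u v} → Reach B u v → Reach C u v
Reach-mono B⊆C here = here
Reach-mono B⊆C (step e r) = step (B⊆C e) (Reach-mono B⊆C r)

firstArc : ∀ {n} {B : ArcSet n} {u v} → Reach B u v → u ≢ v → ∃ λ w → B u w ≡ true
firstArc here u≢u = contradiction refl u≢u
firstArc (step {w = w} e _) _ = w , e

lastArc : ∀ {n} {B : ArcSet n} {u v} → Reach B u v → u ≢ v → ∃ λ w → B w v ≡ true
lastArc here u≢u = contradiction refl u≢u
lastArc {u = u} {v} (step {w = w} e r) _ with w ≟ v
... | yes refl = u , e
... | no w≢v = lastArc r w≢v

strong⇒arcStrong1 : ∀ {D} → Strong D → ArcStrong D 1
strong⇒arcStrong1 strong X _ |X|<1 u v = Reach-mono keep (strong u v)
  where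
  X-empty : ∀ i j → X i j ≡ false
  X-empty i j with X i j in ij∈X
  ... | true = contradiction (≤-trans (nonempty⇒0<length (∈-arcList X ij∈X))
                              (≤-reflexive (length-arcList X))) (<⇒≱ |X|<1)
  ... | false = refl
  keep : ∀ {i j} → _ ≡ true → _ ≡ true
  keep {i} {j} ij∈D = cong₂ (λ x y → x ∧ not y) ij∈D (X-empty i j)

Distinct : ∀ {n} → ℕ → (Fin n → Bool) → Set
Distinct {n} k P = Σ (Fin k → Fin n) λ w → Injective _≡_ _≡_ w × ∀ i → P (w i) ≡ true

distinct⇒≤count : ∀ {n k} {P : Fin n → Bool} → Distinct k P → k ≤ ∣ tabulate P ∣
distinct⇒≤count {P = P} (w , w-inj , Pw) = ≤-trans
  (injective⇒≤length (trues P) w w-inj λ i → ∈-trues P (Pw i))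
  (≤-reflexive (length-trues P))

ArcDisjoint : ∀ {D : Digraph} {k} → (Fin k → Subgraph D) → Set
ArcDisjoint F = ∀ i j → i ≢ j → ∀ a b → arcs (F i) a b ≡ true → arcs (F j) a b ≡ false

DisjointReach : (D : Digraph) → ℕ → Fin (n D) → Fin (n D) → Set
DisjointReach D k p q =
  Σ (Fin k → Subgraph D) λ F → ArcDisjoint F × ∀ i → Reach (arcs (F i)) p q

arc-owner-unique : ∀ {D : Digraph} {k} (F : Fin k → Subgraph D) → ArcDisjoint F →
  (a b : Fin k → Fin (n D)) → (∀ i → arcs (F i) (a i) (b i) ≡ true) →
  ∀ {i j} → a i ≡ a j → b i ≡ b j → i ≡ j
arc-owner-unique F disjoint a b ab∈F {i} {j} aᵢ≡aⱼ bᵢ≡bⱼ with i ≟ j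
... | yes i≡j = i≡j
... | no i≢j = contradiction
  (trans (sym (disjoint i j i≢j (a i) (b i) (ab∈F i)))
         (subst₂ (λ x y → arcs (F j) x y ≡ true) (sym aᵢ≡aⱼ) (sym bᵢ≡bⱼ) (ab∈F j)))
  λ ()

disjointReach⇒distinctOut : ∀ {D k p q} → p ≢ q → DisjointReach D k p q →
  Distinct k (adj D p)
disjointReach⇒distinctOut {D} {p = p} p≢q (F , disjoint , reach) =
  w , (λ wᵢ≡wⱼ → arc-owner-unique F disjoint (λ _ → p) w pw∈F refl wᵢ≡wⱼ) ,
  λ i → arcs⊆ (F i) p (w i) (pw∈F i)
  where
  w : _ → Fin (n D)
  w i = proj₁ (firstArc (reach i) p≢q)
  pw∈F : ∀ i → arcs (F i) p (w i) ≡ true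
  pw∈F i = proj₂ (firstArc (reach i) p≢q)

disjointReach⇒distinctIn : ∀ {D k p q} → p ≢ q → DisjointReach D k p q →
  Distinct k (λ w → adj D w q)
disjointReach⇒distinctIn {D} {q = q} p≢q (F , disjoint , reach) =
  w , (λ wᵢ≡wⱼ → arc-owner-unique F disjoint w (λ _ → q) wq∈F wᵢ≡wⱼ refl) ,
  λ i → arcs⊆ (F i) (w i) q (wq∈F i)
  where
  w : _ → Fin (n D)
  w i = proj₁ (lastArc (reach i) p≢q)
  wq∈F : ∀ i → arcs (F i) (w i) q ≡ true
  wq∈F i = proj₂ (lastArc (reach i) p≢q)

hasDisjoint⇒disjointReach : ∀ {D S k p q} → HasDisjoint D S k → p ∈ S → q ∈ S →
  DisjointReach D k p q
hasDisjoint⇒disjointReach (F , strong , disjoint) p∈S q∈S =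
  F , disjoint , λ i → proj₂ (strong i) _ _ (proj₁ (strong i) p∈S) (proj₁ (strong i) q∈S)

hasDisjoint-≤ : ∀ {D S k l} → HasDisjoint D S l → k ≤ l → HasDisjoint D S k
hasDisjoint-≤ (F , strong , disjoint) k≤l =
  (λ i → F (inject≤ i k≤l)) , (λ i → strong (inject≤ i k≤l)) ,
  λ i j i≢j → disjoint _ _ λ e → i≢j (inject≤-injective k≤l k≤l i j e)

pair-disjoint-≤outdeg : ∀ {D k p q} → p ≢ q → HasDisjoint D (pair p q) k → k ≤ outdeg D p
pair-disjoint-≤outdeg {p = p} {q} p≢q disjoint = distinct⇒≤count (disjointReach⇒distinctOut p≢q
  (hasDisjoint⇒disjointReach disjoint (∈-pairˡ p q) (∈-pairʳ p q)))

¬¬-greatest : (P : ℕ → Set) (t : ℕ) → P 0 → (∀ k → P k → k ≤ t) →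
  ¬ ¬ (Σ ℕ λ l → P l × ∀ k → P k → k ≤ l)
¬¬-greatest P zero P0 bounded none = none (0 , P0 , bounded)
¬¬-greatest P (suc t) P0 bounded none = ¬¬-excluded-middle λ
  { (yes P[1+t]) → none (suc t , P[1+t] , bounded)
  ; (no ¬P[1+t]) → ¬¬-greatest P t P0
      (λ k Pk → ≤-pred (≤∧≢⇒< (bounded k Pk) λ { refl → ¬P[1+t] Pk })) none }

¬¬-→ : ∀ {A B : Set} → (A → ¬ ¬ B) → ¬ ¬ (A → B)
¬¬-→ f ¬[A→B] = ¬[A→B] λ a → ⊥-elim (f a λ b → ¬[A→B] λ _ → b)

¬¬-∀Fin : ∀ {n} {P : Fin n → Set} → (∀ i → ¬ ¬ P i) → ¬ ¬ (∀ i → P i)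
¬¬-∀Fin = sequence (RawMonad.rawApplicative (¬¬-Monad {0ℓ}))

AllPairsLinked : Digraph → ℕ → Set
AllPairsLinked D k = ∀ p q → p ≢ q → DisjointReach D k p q

-- HasDisjoint is not decidable, so the maximum λ_S(D) is only known to exist under double
-- negation; this suffices because the final goal m ≤ bound G H lG lH is decidable.
λ₂-linked : ∀ {D m} → IsLambdaK 2 D m → ¬ ¬ AllPairsLinked D m
λ₂-linked {D} {m} (minimal , _) =
  ¬¬-map linked (¬¬-∀Fin λ p → ¬¬-∀Fin λ q → ¬¬-→ λ p≢q →
    ¬¬-greatest (HasDisjoint D (pair p q)) (outdeg D p) ((λ ()) , (λ ()) , λ ())
      λ _ → pair-disjoint-≤outdeg p≢q)
  where
  linked : (∀ p q → p ≢ q → Σ ℕ (IsLambdaS D (pair p q))) → AllPairsLinked D m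
  linked λS p q p≢q with λS p q p≢q
  ... | l , isλS = hasDisjoint⇒disjointReach
    (hasDisjoint-≤ (proj₁ isλS) (minimal (pair p q) (∣pair∣≡2 p≢q) l isλS))
    (∈-pairˡ p q) (∈-pairʳ p q)

-- The shape shared by G □ H over G (with n H layers) and over H (with n G layers).
record Layered (D A : Digraph) (ℓ : ℕ) : Set where
  field
    base      : Fin (n D) → Fin (n A)
    layer     : Fin (n D) → Fin ℓ
    separates : ∀ {p q} → base p ≡ base q → layer p ≡ layer q → p ≡ q
    arc-split : ∀ {p q} → adj D p q ≡ true →
                (adj A (base p) (base q) ≡ true × layer p ≡ layer q) ⊎ base p ≡ base q

module LayeredBounds {D A : Digraph} {ℓ : ℕ} (L : Layered D A ℓ) where
  open Layered L

  record ArcOver (X : ArcSet (n A)) (B : ArcSet (n D)) : Set where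
    field
      tail head : Fin (n D)
      ∈B        : B tail head ≡ true
      ∈X        : X (base tail) (base head) ≡ true
      flat      : layer tail ≡ layer head

  project : ∀ (X : ArcSet (n A)) {B : ArcSet (n D)} →
    (∀ {a b} → B a b ≡ true → adj D a b ≡ true) →
    ∀ {p q} → Reach B p q → Reach (adj (removeArcs A X)) (base p) (base q) ⊎ ArcOver X B
  project X B⊆D here = inj₁ here
  project X B⊆D (step {u = p} {w} e r) with project X B⊆D r
  ... | inj₂ over = inj₂ over
  ... | inj₁ r′ with arc-split (B⊆D e)
  ...   | inj₂ same-base =
    inj₁ (subst (λ x → Reach (adj (removeArcs A X)) x (base _)) (sym same-base) r′)
  ...   | inj₁ (pw∈A , flat) with X (base p) (base w) in pw∈X
  ...     | true = inj₂ (record { tail = p ; head = w ; ∈B = e ; ∈X = pw∈X ; flat = flat })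
  ...     | false = inj₁ (step (cong₂ (λ x y → x ∧ not y) pw∈A pw∈X) r′)

  -- Either one of the subgraphs avoids X after projection, or each of them uses its own
  -- arc lying over X, and these arcs are told apart by the arc of X and the layer.
  cut : ∀ (X : ArcSet (n A)) {k p q} → DisjointReach D k p q →
    Reach (adj (removeArcs A X)) (base p) (base q) ⊎ k ≤ arcCount X * ℓ
  cut X {k} (F , disjoint , reach)
    with sequence (SumLeft.applicative _ 0ℓ) (λ i → project X (arcs⊆ (F i) _ _) (reach i))
  ... | inj₁ r = inj₁ r
  ... | inj₂ over = inj₂ (≤-trans
    (injective⇒≤length (cartesianProduct (arcList X) (allFin ℓ)) tag tag-injective tag∈)
    (≤-reflexive (trans (length-cartesianProduct (arcList X) (allFin ℓ))
                        (cong₂ _*_ (length-arcList X) (length-tabulate (λ i → i))))))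
    where
    open ArcOver
    tag : Fin k → (Fin (n A) × Fin (n A)) × Fin ℓ
    tag i = (base (tail (over i)) , base (head (over i))) , layer (tail (over i))
    tag∈ : ∀ i → tag i ∈ₗ cartesianProduct (arcList X) (allFin ℓ)
    tag∈ i = ∈-cartesianProduct⁺ (∈-arcList X (∈X (over i))) (∈-allFin _)
    tag-injective : Injective _≡_ _≡_ tag
    tag-injective {i} {j} same = arc-owner-unique F disjoint (tail ∘ over) (head ∘ over) (∈B ∘ over)
      (separates (cong (proj₁ ∘ proj₁) same) (cong proj₂ same))
      (separates (cong (proj₂ ∘ proj₁) same)
        (trans (sym (flat (over i))) (trans (cong proj₂ same) (flat (over j)))))

  ≤-arcConn : ∀ {k l} (lift : Fin (n A) → Fin (n D)) → (∀ u → base (lift u) ≡ u) →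
    (∀ u v → u ≢ v → DisjointReach D k (lift u) (lift v)) → IsArcConn A l → k ≤ l * ℓ
  ≤-arcConn {k} {l} lift base-lift linked (_ , ¬strong) with k ≤? l * ℓ
  ... | yes k≤lℓ = k≤lℓ
  ... | no k≰lℓ = contradiction strong ¬strong
    where
    strong : ArcStrong A (suc l)
    strong X _ |X|≤l u v with u ≟ v
    ... | yes refl = here
    ... | no u≢v with cut X (linked u v u≢v)
    ...   | inj₁ r = subst₂ (Reach _) (base-lift u) (base-lift v) r
    ...   | inj₂ k≤ = contradiction (≤-trans k≤ (*-monoˡ-≤ ℓ (≤-pred |X|≤l))) k≰lℓ

minFin-attained : ∀ n (f : Fin n → ℕ) → 1 ≤ n → ∃ λ i → minFin n f ≡ f i
minFin-attained (suc zero) f _ = zero , refl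
minFin-attained (suc (suc n)) f _
  with ⊓-sel (f zero) (minFin (suc n) (f ∘ suc)) | minFin-attained (suc n) (f ∘ suc) (s≤s z≤n)
... | inj₁ min≡f0 | _ = zero , min≡f0
... | inj₂ min≡rest | i , rest≡fi = suc i , trans min≡rest rest≡fi

≤-minFin+minFin : ∀ {a b m} {f : Fin a → ℕ} {g : Fin b → ℕ} → 1 ≤ a → 1 ≤ b →
  (∀ x y → m ≤ f x + g y) → m ≤ minFin a f + minFin b g
≤-minFin+minFin {a} {b} {f = f} {g} 1≤a 1≤b m≤ with minFin-attained a f 1≤a | minFin-attained b g 1≤b
... | x , min-f≡fx | y , min-g≡gy = subst₂ (λ s t → _ ≤ s + t) (sym min-f≡fx) (sym min-g≡gy) (m≤ x y)

another : ∀ {n} → 2 ≤ n → (x : Fin n) → ∃ λ x′ → x′ ≢ x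
another {suc (suc _)} _ x = punchIn x zero , punchInᵢ≢i x zero
another {suc zero} (s≤s ()) _

module Product (G H : Digraph) where
  N : ℕ
  N = n G * n H

  πG : Fin N → Fin (n G)
  πG p = proj₁ (remQuot {n G} (n H) p)

  πH : Fin N → Fin (n H)
  πH p = proj₂ (remQuot {n G} (n H) p)

  π-injective : ∀ {p q} → πG p ≡ πG q → πH p ≡ πH q → p ≡ q
  π-injective {p} {q} πGp≡πGq πHp≡πHq = begin
    p                     ≡⟨ combine-remQuot {n G} (n H) p ⟨
    combine (πG p) (πH p) ≡⟨ cong₂ combine πGp≡πGq πHp≡πHq ⟩
    combine (πG q) (πH q) ≡⟨ combine-remQuot {n G} (n H) q ⟩
    q                     ∎
    where open ≡-Reasoning

  arc-□ : ∀ {p q} → adj (G □ H) p q ≡ true →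
    (adj G (πG p) (πG q) ≡ true × πH p ≡ πH q) ⊎ (πG p ≡ πG q × adj H (πH p) (πH q) ≡ true)
  arc-□ {p} {q} pq∈D with ∨≡true (adj G (πG p) (πG q) ∧ eqF (πH p) (πH q)) pq∈D
  ... | inj₁ e = inj₁ (∧-conicalˡ _ _ e , eqF⇒≡ (∧-conicalʳ _ _ e))
  ... | inj₂ e = inj₂ (eqF⇒≡ (∧-conicalˡ _ _ e) , ∧-conicalʳ _ _ e)

  layeredG : Layered (G □ H) G (n H)
  layeredG = record
    { base = πG ; layer = πH ; separates = π-injective
    ; arc-split = λ e → map₂ proj₁ (arc-□ e) }

  layeredH : Layered (G □ H) H (n G)
  layeredH = record
    { base = πH ; layer = πG ; separates = flip π-injective
    ; arc-split = λ e → [ inj₂ ∘ proj₂ , (λ (same , a) → inj₁ (a , same)) ] (arc-□ e) }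

  data Near (RG : Fin (n G) → Bool) (RH : Fin (n H) → Bool) (p : Fin N) : Fin N → Set where
    alongG : ∀ {w} → RG (πG w) ≡ true → πH w ≡ πH p → Near RG RH p w
    alongH : ∀ {w} → πG w ≡ πG p → RH (πH w) ≡ true → Near RG RH p w

  moved : ∀ {RG RH p w} → Near RG RH p w → Fin (n G) ⊎ Fin (n H)
  moved {w = w} (alongG _ _) = inj₁ (πG w)
  moved {w = w} (alongH _ _) = inj₂ (πH w)

  moved-injective : ∀ {RG RH p w w′} (c : Near RG RH p w) (c′ : Near RG RH p w′) →
    moved c ≡ moved c′ → w ≡ w′
  moved-injective (alongG _ πHw≡) (alongG _ πHw′≡) same =
    π-injective (inj₁-injective same) (trans πHw≡ (sym πHw′≡))
  moved-injective (alongH πGw≡ _) (alongH πGw′≡ _) same =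
    π-injective (trans πGw≡ (sym πGw′≡)) (inj₂-injective same)
  moved-injective (alongG _ _) (alongH _ _) ()
  moved-injective (alongH _ _) (alongG _ _) ()

  ≤-near : ∀ {k RG RH p} (w : Fin k → Fin N) → Injective _≡_ _≡_ w →
    (∀ i → Near RG RH p (w i)) → k ≤ ∣ tabulate RG ∣ + ∣ tabulate RH ∣
  ≤-near {RG = RG} {RH} w w-injective near = ≤-trans
    (injective⇒≤length candidates (moved ∘ near)
      (λ same → w-injective (moved-injective (near _) (near _) same)) moved∈)
    (≤-reflexive (trans (length-++ (map inj₁ (trues RG)))
      (cong₂ _+_ (trans (length-map inj₁ (trues RG)) (length-trues RG))
                 (trans (length-map inj₂ (trues RH)) (length-trues RH)))))
    where
    candidates : List (Fin (n G) ⊎ Fin (n H))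
    candidates = map inj₁ (trues RG) ++ map inj₂ (trues RH)
    moved∈ : ∀ i → moved (near i) ∈ₗ candidates
    moved∈ i with near i
    ... | alongG RGw _ = ∈-++⁺ˡ (∈-map⁺ inj₁ (∈-trues RG RGw))
    ... | alongH _ RHw = ∈-++⁺ʳ (map inj₁ (trues RG)) (∈-map⁺ inj₂ (∈-trues RH RHw))

  ≤-outdeg-□ : ∀ {k p} → Distinct k (adj (G □ H) p) → k ≤ outdeg G (πG p) + outdeg H (πH p)
  ≤-outdeg-□ (w , w-injective , pw∈D) = ≤-near w w-injective λ i → out-near (pw∈D i)
    where
    out-near : ∀ {p w} → adj (G □ H) p w ≡ true → Near (adj G (πG p)) (adj H (πH p)) p w
    out-near pw∈D with arc-□ pw∈D
    ... | inj₁ (pw∈G , same) = alongG pw∈G (sym same)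
    ... | inj₂ (same , pw∈H) = alongH (sym same) pw∈H

  ≤-indeg-□ : ∀ {k p} → Distinct k (λ w → adj (G □ H) w p) → k ≤ indeg G (πG p) + indeg H (πH p)
  ≤-indeg-□ (w , w-injective , wp∈D) = ≤-near w w-injective λ i → in-near (wp∈D i)
    where
    in-near : ∀ {p w} → adj (G □ H) w p ≡ true →
      Near (λ x → adj G x (πG p)) (λ y → adj H y (πH p)) p w
    in-near wp∈D with arc-□ wp∈D
    ... | inj₁ (wp∈G , same) = alongG wp∈G same
    ... | inj₂ (same , wp∈H) = alongH same wp∈H

  ≤-outdeg+outdeg : ∀ {m} → 2 ≤ n G → AllPairsLinked (G □ H) m →
    ∀ x y → m ≤ outdeg G x + outdeg H y
  ≤-outdeg+outdeg 2≤nG linked x y with another 2≤nG x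
  ... | x′ , x′≢x = subst (λ (a , b) → _ ≤ outdeg G a + outdeg H b) (remQuot-combine x y)
    (≤-outdeg-□ (disjointReach⇒distinctOut p≢q (linked _ _ p≢q)))
    where
    p≢q : combine x y ≢ combine x′ y
    p≢q = x′≢x ∘ sym ∘ combine-injectiveˡ x y x′ y

  ≤-indeg+indeg : ∀ {m} → 2 ≤ n G → AllPairsLinked (G □ H) m →
    ∀ x y → m ≤ indeg G x + indeg H y
  ≤-indeg+indeg 2≤nG linked x y with another 2≤nG x
  ... | x′ , x′≢x = subst (λ (a , b) → _ ≤ indeg G a + indeg H b) (remQuot-combine x y)
    (≤-indeg-□ (disjointReach⇒distinctIn q≢p (linked _ _ q≢p)))
    where
    q≢p : combine x′ y ≢ combine x y
    q≢p = x′≢x ∘ combine-injectiveˡ x′ y x y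

  ≤-λG : ∀ {m lG} → Fin (n H) → AllPairsLinked (G □ H) m → IsArcConn G lG → m ≤ lG * n H
  ≤-λG y linked = ≤-arcConn (λ x → combine x y) (λ x → cong proj₁ (remQuot-combine x y))
    λ u v u≢v → linked _ _ (u≢v ∘ combine-injectiveˡ u y v y)
    where open LayeredBounds layeredG

  ≤-λH : ∀ {m lH} → Fin (n G) → AllPairsLinked (G □ H) m → IsArcConn H lH → m ≤ lH * n G
  ≤-λH x linked = ≤-arcConn (combine x) (λ y → cong proj₂ (remQuot-combine x y))
    λ u v u≢v → linked _ _ (u≢v ∘ combine-injectiveʳ x u x v)
    where open LayeredBounds layeredH

upper-bound : ∀ {G H lG lH m} → Admissible G → Admissible H → IsArcConn G lG → IsArcConn H lH →
  AllPairsLinked (G □ H) m → m ≤ bound G H lG lH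
upper-bound {G} {H} (_ , _ , 2≤nG) (_ , _ , 2≤nH) connG connH linked = ⊓-glb
  (⊓-glb (≤-λG (fromℕ< 0<nH) linked connG) (≤-λH (fromℕ< 0<nG) linked connH))
  (⊓-glb (≤-minFin+minFin 0<nG 0<nH (≤-outdeg+outdeg 2≤nG linked))
         (≤-minFin+minFin 0<nG 0<nH (≤-indeg+indeg 2≤nG linked)))
  where
  open Product G H
  0<nG : 0 < n G
  0<nG = ≤-trans (s≤s z≤n) 2≤nG
  0<nH : 0 < n H
  0<nH = ≤-trans (s≤s z≤n) 2≤nH

K₂ : Digraph
K₂ = digraph 2 λ i j → not (eqF i j)

K₂-admissible : Admissible K₂
K₂-admissible = (λ i → cong not (eqF-refl i)) , strong , s≤s (s≤s z≤n)
  where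
  strong : Strong K₂
  strong zero zero = here
  strong zero (suc zero) = step refl here
  strong (suc zero) zero = step refl here
  strong (suc zero) (suc zero) = here

K₂-not-2-arc-strong : ¬ ArcStrong K₂ 2
K₂-not-2-arc-strong strong = unreachable (strong X X⊆K₂ (s≤s (s≤s z≤n)) zero (suc zero))
  where
  X : ArcSet 2
  X i j = eqF i zero ∧ eqF j (suc zero)
  X⊆K₂ : ∀ i j → X i j ≡ true → adj K₂ i j ≡ true
  X⊆K₂ zero (suc zero) _ = refl
  X⊆K₂ zero zero ()
  X⊆K₂ (suc zero) _ ()
  unreachable : ¬ Reach (adj (removeArcs K₂ X)) zero (suc zero)
  unreachable (step {w = zero} () _)
  unreachable (step {w = suc zero} () _)

K₂-arcConn : IsArcConn K₂ 1
K₂-arcConn = strong⇒arcStrong1 (proj₁ (proj₂ K₂-admissible)) , K₂-not-2-arc-strong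

Q₂ : Digraph
Q₂ = K₂ □ K₂

-- Vertex i of Q₂ is (i / 2 , i % 2); next runs around the 4-cycle 0 → 1 → 3 → 2 → 0.
next : Fin 4 → Fin 4
next zero = suc zero
next (suc zero) = suc (suc (suc zero))
next (suc (suc (suc zero))) = suc (suc zero)
next (suc (suc zero)) = zero

ring : ArcSet 4
ring i j = eqF (next i) j

ring-both-ways-in-Q₂ : ∀ i → adj Q₂ i (next i) ≡ true × adj Q₂ (next i) i ≡ true
ring-both-ways-in-Q₂ zero = refl , refl
ring-both-ways-in-Q₂ (suc zero) = refl , refl
ring-both-ways-in-Q₂ (suc (suc zero)) = refl , refl
ring-both-ways-in-Q₂ (suc (suc (suc zero))) = refl , refl

next²≢id : ∀ i → eqF (next (next i)) i ≡ false
next²≢id zero = refl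
next²≢id (suc zero) = refl
next²≢id (suc (suc zero)) = refl
next²≢id (suc (suc (suc zero))) = refl

ring-antisymmetric : ∀ i j → ring i j ≡ true → ring j i ≡ false
ring-antisymmetric i j ij∈ring = subst (λ j → ring j i ≡ false) (eqF⇒≡ ij∈ring) (next²≢id i)

ring-strong : ∀ u v → Reach ring u v
ring-strong u v = Reach-trans (to-0 u) (from-0 v)
  where
  forward : ∀ {u v} → Reach ring (next u) v → Reach ring u v
  forward = step (eqF-refl _)
  from-0 : ∀ v → Reach ring zero v
  from-0 zero = here
  from-0 (suc zero) = forward here
  from-0 (suc (suc (suc zero))) = forward (forward here)
  from-0 (suc (suc zero)) = forward (forward (forward here))
  to-0 : ∀ u → Reach ring u zero
  to-0 zero = here
  to-0 (suc (suc zero)) = forward here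
  to-0 (suc (suc (suc zero))) = forward (forward here)
  to-0 (suc zero) = forward (forward (forward here))

opposite-rings : Fin 2 → Subgraph Q₂
opposite-rings zero = subgraph ⊤ ring
  (λ i j ij∈ring → subst (λ j → adj Q₂ i j ≡ true) (eqF⇒≡ ij∈ring) (proj₁ (ring-both-ways-in-Q₂ i)))
  λ _ _ _ → ∈⊤ , ∈⊤
opposite-rings (suc zero) = subgraph ⊤ (flip ring)
  (λ i j ji∈ring → subst (λ i → adj Q₂ i j ≡ true) (eqF⇒≡ ji∈ring) (proj₂ (ring-both-ways-in-Q₂ j)))
  λ _ _ _ → ∈⊤ , ∈⊤

Q₂-two-disjoint : ∀ S → HasDisjoint Q₂ S 2
Q₂-two-disjoint S = opposite-rings , strong , disjoint
  where
  strong : ∀ i → IsSStrong Q₂ S (opposite-rings i)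
  strong zero = (λ _ → ∈⊤) , λ u v _ _ → ring-strong u v
  strong (suc zero) = (λ _ → ∈⊤) , λ u v _ _ → Reach-reverse (ring-strong v u)
  disjoint : ArcDisjoint opposite-rings
  disjoint zero zero i≢i = contradiction refl i≢i
  disjoint zero (suc zero) _ = ring-antisymmetric
  disjoint (suc zero) zero _ a b = ring-antisymmetric b a
  disjoint (suc zero) (suc zero) i≢i = contradiction refl i≢i

Q₂-λ₂ : IsLambdaK 2 Q₂ 2
Q₂-λ₂ = (λ S _ l isλS → proj₂ isλS 2 (Q₂-two-disjoint S)) ,
  pair zero (suc zero) , ∣pair∣≡2 0≢1 , Q₂-two-disjoint _ , λ _ → pair-disjoint-≤outdeg 0≢1
  where
  0≢1 : _≢_ {A = Fin 4} zero (suc zero)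
  0≢1 ()

theorem4p1 : ((G H : Digraph) → Admissible G → Admissible H →
      (lG lH m : ℕ) → IsArcConn G lG → IsArcConn H lH →
      IsLambdaK 2 (G □ H) m → m ≤ bound G H lG lH)
    ×
    (Σ Digraph λ G → Σ Digraph λ H → Admissible G × Admissible H ×
      Σ ℕ λ lG → Σ ℕ λ lH → Σ ℕ λ m →
      IsArcConn G lG × IsArcConn H lH × IsLambdaK 2 (G □ H) m ×
      m ≡ bound G H lG lH)
theorem4p1 =
  (λ G H admG admH lG lH m connG connH λ₂≡m →
    decidable-stable (m ≤? bound G H lG lH)
      (¬¬-map (upper-bound admG admH connG connH) (λ₂-linked λ₂≡m))) ,
  (K₂ , K₂ , K₂-admissible , K₂-admissible , 1 , 1 , 2 , K₂-arcConn , K₂-arcConn , Q₂-λ₂ , refl)
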